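{- Let $n\ge 1$, and fix integers $1\le k\le n$ and $0\le j\le k-1$. (1) For every integer $a$ with $1\le a\le n-k+1$, the number of permutations $\sigma\in S_n$ with $\operatorname{maj}(\sigma^{ -1})\equiv j\pmod k$ and $n-a-k+2\le \sigma^{ -1}(n)\le n-a+1$ equals $(n-1)!$. (2) Write $n=qk+r$ with $0\le r\le k-1$, and fix an integer $s$ with $1\le s\le q$. Then the number of permutations $\sigma\in S_n$ with $\operatorname{maj}(\sigma^{ -1})\equiv j\pmod k$ and $n-sk+1\le \sigma^{ -1}(n)\le n$ equals $s\,(n-1)!$.
   Context: $S_n$ is the symmetric group on $\{1,\ldots,n\}$. For $\sigma\in S_n$ and $1\le t\le n-1$, $t$ is a descent of $\sigma$ if $\sigma(t)>\sigma(t+1)$; the major index $\operatorname{maj}(\sigma)$ is the sum of the descents of $\sigma$. $\sigma^{ -1}$ is the inverse permutation, so $\sigma^{ -1}(n)$ is the position of the letter $n$ in the word $\sigma(1)\cdots\sigma(n)$. -}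

module Defs where

open import Data.Nat using (_<ᵇ_; ℕ; zero; suc; _+_; _∸_; _<_; _≤_; _<?_; _≤?_; _%_; NonZero)
open import Data.Nat.Properties using (_≟_)
open import Data.Fin using (Fin; toℕ; fromℕ)
import Data.Fin as F
open import Data.Vec using (Vec; []; _∷_; toList; lookup)
open import Data.List using (List; []; _∷_; map; concatMap; filter; length; allFin; sum)
open import Data.List.Relation.Unary.AllPairs using (AllPairs; allPairs?)
open import Data.Bool using (if_then_else_)
open import Data.Product using (_×_)
open import Relation.Binary.PropositionalEquality using (_≡_; _≢_)
open import Relation.Nullary using (Dec; yes; no; ¬?)
open import Relation.Nullary.Decidable using (_×-dec_)

-- A permutation σ ∈ S_n is represented by its one-line word σ(1)⋯σ(n),
-- a vector of letters in Fin n (letter i ∈ Fin n stands for i+1),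
-- whose entries are pairwise distinct.
Word : ℕ → Set
Word n = Vec (Fin n) n

IsPerm : ∀ {n} → Word n → Set
IsPerm w = AllPairs _≢_ (toList w)

isPerm? : ∀ {n} (w : Word n) → Dec (IsPerm w)
isPerm? w = allPairs? (λ x y → ¬? (x F.≟ y)) (toList w)

allVecs : ∀ {n} (m : ℕ) → List (Vec (Fin n) m)
allVecs zero = [] ∷ []
allVecs {n} (suc m) = concatMap (λ x → map (x ∷_) (allVecs m)) (allFin n)

-- 1-based position of the first occurrence of letter v in a list (length+1 if absent)
posL : ∀ {n} → List (Fin n) → Fin n → ℕ
posL [] v = 1
posL (x ∷ xs) v with x F.≟ v
... | yes _ = 1
... | no _ = suc (posL xs v)

-- σ⁻¹(v+1) as a 1-based natural number: the position of letter v in the word of σ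
invAt : ∀ {n} → Word n → Fin n → ℕ
invAt w v = posL (toList w) v

invWord : ∀ {n} → Word n → List ℕ
invWord {n} w = map (invAt w) (allFin n)

-- major index of a word a₁⋯a_m: sum of t (1-based) with a_t > a_{t+1}
-- majFrom t a xs: a is the entry at position t, xs the entries after it
majFrom : ℕ → ℕ → List ℕ → ℕ
majFrom t a [] = 0
majFrom t a (b ∷ xs) = (if b <ᵇ a then t else 0) + majFrom (suc t) b xs

maj : List ℕ → ℕ
maj [] = 0
maj (a ∷ xs) = majFrom 1 a xs

majInv : ∀ {n} → Word n → ℕ
majInv w = maj (invWord w)

-- σ⁻¹(n), the (1-based) position of the largest letter n (n = suc m)
posMax : ∀ {m} → Word (suc m) → ℕ
posMax {m} w = invAt w (fromℕ m)

countPerms : ∀ n {P : Word n → Set} → ((w : Word n) → Dec (P w)) → ℕ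
countPerms n P? = length (filter (λ w → isPerm? w ×-dec P? w) (allVecs n))

Cond : ∀ {m} (k j lo hi : ℕ) .{{_ : NonZero k}} → Word (suc m) → Set
Cond k j lo hi w = (majInv w % k ≡ j) × (lo ≤ posMax w × posMax w ≤ hi)

cond? : ∀ {m} (k j lo hi : ℕ) .{{_ : NonZero k}} (w : Word (suc m)) → Dec (Cond k j lo hi w)
cond? k j lo hi w = (majInv w % k ≟ j) ×-dec ((lo ≤? posMax w) ×-dec (posMax w ≤? hi))

module Submission where

-- Rotating a word, σ(1)⋯σ(n) ↦ σ(n)σ(1)⋯σ(n−1), is a bijection. When σ(n) ≠ n it moves the
-- letter n one place to the right and turns every value x of σ⁻¹ into x + 1, except that the entry
-- n becomes 1: the descent right after that entry disappears and one appears right before it, so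
-- maj(σ⁻¹) drops by one. Hence maj(σ⁻¹) + σ⁻¹(n) is invariant, and for every weight g the sum of
-- g(maj(σ⁻¹) + σ⁻¹(n)) over the σ with σ⁻¹(n) = p is the same for all p ∈ [1, n]; for g = 1 these
-- n sums add up to n!. When p runs over k consecutive values, the conditions maj(σ⁻¹) ≡ j (mod k)
-- read maj(σ⁻¹) + σ⁻¹(n) ≡ j + p (mod k), and exactly one of them holds; so a window of k
-- consecutive positions of n contributes (n−1)!, and the range in part (2) is a union of s windows.

open import Defs

open import Data.Bool.Base using (true; false; if_then_else_)
open import Data.Bool.Properties using (T-≡)
open import Data.Fin.Base using (Fin; zero; suc; fromℕ; punchOut) renaming (_<_ to _<ᶠ_)
import Data.Fin.Properties as Fin
open import Data.List.Base using (List; []; _∷_; _++_; [_]; map; concatMap; filter; length; tabulate; allFin; upTo)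
open import Data.List.Membership.Propositional using (_∈_; _∉_)
open import Data.List.Membership.Propositional.Properties using (∈-allFin; ∈-upTo⁺; ∈-upTo⁻; ∈-∃++; ∈-++⁻)
open import Data.List.Properties
  using (map-++; map-∘; map-cong-local; map-tabulate; length-tabulate; upTo-∷ʳ; map-upTo; map-applyUpTo; length-upTo;
         ∷ʳ-injectiveʳ)
open import Data.List.Relation.Unary.All using (All; []; _∷_)
import Data.List.Relation.Unary.All as All
open import Data.List.Relation.Unary.All.Properties using (¬Any⇒All¬; All¬⇒¬Any)
import Data.List.Relation.Unary.All.Properties as All
open import Data.List.Relation.Unary.AllPairs using ([]; _∷_)
open import Data.List.Relation.Unary.Any using (here; there; any?)
open import Data.List.Relation.Unary.Unique.Propositional using (Unique)
open import Data.List.Relation.Unary.Unique.Propositional.Properties using (allFin⁺; upTo⁺; Unique[x∷xs]⇒x∉xs)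
open import Data.Nat.Base
  using (ℕ; zero; suc; _+_; _*_; _∸_; _!; pred; _<ᵇ_; _≤_; _<_; z≤n; s≤s; s≤s⁻¹; z<s; s<s; s<s⁻¹; _%_; _/_;
         NonZero; >-nonZero⁻¹)
open import Data.Nat using (_≤?_; _<?_)
open import Data.Nat.DivMod using (m<n⇒m%n≡m; m%n<n; [m+n]%n≡m%n; [m+kn]%n≡m%n; %-distribˡ-+; m/n*n≤m)
open import Data.Nat.ListAction using (sum)
open import Data.Nat.ListAction.Properties using (sum-++)
open import Data.Nat.Properties
open import Algebra.Properties.CommutativeSemigroup +-commutativeSemigroup using (interchange)
open import Data.Product.Base using (_×_; _,_; proj₂; ∃; ∃₂)
open import Data.Sum.Base using (inj₁; inj₂)
open import Data.Vec.Base using (Vec; []; _∷_; _∷ʳ_; toList; lookup)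
open import Data.Vec.Membership.Propositional.Properties using (∈-toList⁺; ∈-lookup)
open import Data.Vec.Properties using (toList-∷ʳ; length-toList)
import Data.Vec.Relation.Unary.All.Properties as Vecᴬ
open import Data.Vec.Relation.Unary.AllPairs using ([]; _∷_)
import Data.Vec.Relation.Unary.Unique.Propositional as Vecᵘ
open import Data.Vec.Relation.Unary.Unique.Propositional.Properties using (lookup-injective)
open import Function.Base using (id; _∘_)
open import Function.Bundles using (_⇔_; mk⇔; module Equivalence)
open import Relation.Binary.Definitions using (DecidableEquality)
open import Relation.Binary.PropositionalEquality using (_≡_; _≢_; refl; sym; trans; cong; cong₂; subst; module ≡-Reasoning)
open import Relation.Binary.PropositionalEquality.Properties using (setoid)
open import Relation.Nullary.Decidable using (Dec; yes; no; does; _×-dec_; ¬?; does-⇔; dec-true; dec-false)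
open import Relation.Nullary.Negation using (¬_; contradiction)
open import Relation.Unary using (Pred; Decidable)

-- Indicators and finite sums

𝟙 : ∀ {a} {A : Set a} → Dec A → ℕ
𝟙 a? = if does a? then 1 else 0

module _ {a} {A : Set a} where

  𝟙-yes : (a? : Dec A) → A → 𝟙 a? ≡ 1
  𝟙-yes a? x rewrite dec-true a? x = refl

  𝟙-no : (a? : Dec A) → ¬ A → 𝟙 a? ≡ 0
  𝟙-no a? ¬x rewrite dec-false a? ¬x = refl

  𝟙-¬ : (a? : Dec A) → 𝟙 a? + 𝟙 (¬? a?) ≡ 1
  𝟙-¬ a? with does a?
  ... | true  = refl
  ... | false = refl

  𝟙-*-cong : (a? : Dec A) {x y : ℕ} → (A → x ≡ y) → 𝟙 a? * x ≡ 𝟙 a? * y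
  𝟙-*-cong a? x≡y with a?
  ... | yes a = cong (_+ 0) (x≡y a)
  ... | no _  = refl

module _ {a b} {A : Set a} {B : Set b} where

  𝟙-⇔ : A ⇔ B → (a? : Dec A) (b? : Dec B) → 𝟙 a? ≡ 𝟙 b?
  𝟙-⇔ A⇔B a? b? = cong (λ t → if t then 1 else 0) (does-⇔ A⇔B a? b?)

  𝟙-× : (a? : Dec A) (b? : Dec B) → 𝟙 (a? ×-dec b?) ≡ 𝟙 a? * 𝟙 b?
  𝟙-× a? b? with does a? | does b?
  ... | true  | true  = refl
  ... | true  | false = refl
  ... | false | _     = refl

∑ : ∀ {a} {A : Set a} → List A → (A → ℕ) → ℕ
∑ xs f = sum (map f xs)

infix 6.5 ∑
syntax ∑ xs (λ x → e) = ∑[ x ∈ xs ] e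

module _ {a} {A : Set a} where

  ∑-cong : ∀ {f g : A → ℕ} xs → (∀ x → f x ≡ g x) → ∑ xs f ≡ ∑ xs g
  ∑-cong []       f≗g = refl
  ∑-cong (x ∷ xs) f≗g = cong₂ _+_ (f≗g x) (∑-cong xs f≗g)

  ∑-++ : ∀ xs ys (f : A → ℕ) → ∑ (xs ++ ys) f ≡ ∑ xs f + ∑ ys f
  ∑-++ xs ys f = trans (cong sum (map-++ f xs ys)) (sum-++ (map f xs) (map f ys))

  ∑-+ : ∀ xs (f g : A → ℕ) → ∑[ x ∈ xs ] (f x + g x) ≡ ∑ xs f + ∑ xs g
  ∑-+ []       f g = refl
  ∑-+ (x ∷ xs) f g = trans (cong (f x + g x +_) (∑-+ xs f g)) (interchange (f x) (g x) _ _)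

  ∑-*ˡ : ∀ xs c (f : A → ℕ) → ∑[ x ∈ xs ] (c * f x) ≡ c * ∑ xs f
  ∑-*ˡ []       c f = sym (*-zeroʳ c)
  ∑-*ˡ (x ∷ xs) c f = trans (cong (c * f x +_) (∑-*ˡ xs c f)) (sym (*-distribˡ-+ c (f x) _))

  ∑-*ʳ : ∀ xs (f : A → ℕ) c → ∑[ x ∈ xs ] (f x * c) ≡ ∑ xs f * c
  ∑-*ʳ xs f c = trans (∑-cong xs (λ x → *-comm (f x) c)) (trans (∑-*ˡ xs c f) (*-comm c _))

  ∑-const : ∀ (xs : List A) c → ∑[ x ∈ xs ] c ≡ length xs * c
  ∑-const []       c = refl
  ∑-const (x ∷ xs) c = cong (c +_) (∑-const xs c)

  ∑-0 : ∀ (xs : List A) → ∑[ x ∈ xs ] 0 ≡ 0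
  ∑-0 xs = trans (∑-const xs 0) (*-zeroʳ (length xs))

  length-filter-∑ : ∀ {p} {P : Pred A p} (P? : Decidable P) xs → length (filter P? xs) ≡ ∑[ x ∈ xs ] 𝟙 (P? x)
  length-filter-∑ P? []       = refl
  length-filter-∑ P? (x ∷ xs) with does (P? x)
  ... | true  = cong suc (length-filter-∑ P? xs)
  ... | false = length-filter-∑ P? xs

module _ {a b} {A : Set a} {B : Set b} where

  ∑-map : ∀ xs (g : A → B) (f : B → ℕ) → ∑ (map g xs) f ≡ ∑ xs (f ∘ g)
  ∑-map []       g f = refl
  ∑-map (x ∷ xs) g f = cong (f (g x) +_) (∑-map xs g f)

  ∑-concatMap : ∀ xs (g : A → List B) (f : B → ℕ) → ∑ (concatMap g xs) f ≡ ∑[ x ∈ xs ] ∑ (g x) f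
  ∑-concatMap []       g f = refl
  ∑-concatMap (x ∷ xs) g f = trans (∑-++ (g x) (concatMap g xs) f) (cong (∑ (g x) f +_) (∑-concatMap xs g f))

  ∑-swap : ∀ xs ys (f : A → B → ℕ) → ∑[ x ∈ xs ] ∑[ y ∈ ys ] f x y ≡ ∑[ y ∈ ys ] ∑[ x ∈ xs ] f x y
  ∑-swap []       ys f = sym (∑-0 ys)
  ∑-swap (x ∷ xs) ys f = trans (cong (∑[ y ∈ ys ] f x y +_) (∑-swap xs ys f))
                               (sym (∑-+ ys (f x) (λ y → ∑[ x ∈ xs ] f x y)))

module _ {a} {A : Set a} (_≟_ : DecidableEquality A) where

  open import Data.List.Membership.DecPropositional _≟_ using (_∈?_)

  ∑-≟ : ∀ {xs} → Unique xs → ∀ y → ∑[ x ∈ xs ] 𝟙 (y ≟ x) ≡ 𝟙 (y ∈? xs)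
  ∑-≟ {[]}     _          y = refl
  ∑-≟ {x ∷ xs} u@(_ ∷ u′) y with y ≟ x
  ... | yes refl = cong suc (trans (∑-≟ u′ y) (𝟙-no (y ∈? xs) (Unique[x∷xs]⇒x∉xs u)))
  ... | no _     = ∑-≟ u′ y

∑< : ℕ → (ℕ → ℕ) → ℕ
∑< k f = ∑ (upTo k) f

infix 6.5 ∑<
syntax ∑< k (λ i → e) = ∑[ i < k ] e

∑<-suc : ∀ k (f : ℕ → ℕ) → ∑[ i < suc k ] f i ≡ ∑[ i < k ] f i + f k
∑<-suc k f = begin
  ∑ (upTo (suc k)) f      ≡⟨ cong (λ is → ∑ is f) (upTo-∷ʳ k) ⟨
  ∑ (upTo k ++ [ k ]) f   ≡⟨ ∑-++ (upTo k) [ k ] f ⟩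
  ∑< k f + (f k + 0)      ≡⟨ cong (∑< k f +_) (+-identityʳ (f k)) ⟩
  ∑< k f + f k            ∎
  where open ≡-Reasoning

∑<-sucˡ : ∀ k (f : ℕ → ℕ) → ∑[ i < suc k ] f i ≡ f 0 + ∑[ i < k ] f (suc i)
∑<-sucˡ k f = cong (λ xs → f 0 + sum xs) (trans (map-applyUpTo suc f k) (sym (map-upTo (f ∘ suc) k)))

∑<-cong : ∀ k {f g : ℕ → ℕ} → (∀ {i} → i < k → f i ≡ g i) → ∑[ i < k ] f i ≡ ∑[ i < k ] g i
∑<-cong zero    f≗g = refl
∑<-cong (suc k) {f} {g} f≗g = begin
  ∑< (suc k) f   ≡⟨ ∑<-suc k f ⟩
  ∑< k f + f k   ≡⟨ cong₂ _+_ (∑<-cong k (f≗g ∘ m<n⇒m<1+n)) (f≗g ≤-refl) ⟩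
  ∑< k g + g k   ≡⟨ ∑<-suc k g ⟨
  ∑< (suc k) g   ∎
  where open ≡-Reasoning

∑<-+ : ∀ a b (f : ℕ → ℕ) → ∑[ i < a + b ] f i ≡ ∑[ i < a ] f i + ∑[ i < b ] f (a + i)
∑<-+ a zero    f = trans (cong (λ c → ∑< c f) (+-identityʳ a)) (sym (+-identityʳ _))
∑<-+ a (suc b) f = begin
  ∑< (a + suc b) f                              ≡⟨ cong (λ c → ∑< c f) (+-suc a b) ⟩
  ∑< (suc (a + b)) f                            ≡⟨ ∑<-suc (a + b) f ⟩
  ∑< (a + b) f + f (a + b)                      ≡⟨ cong (_+ f (a + b)) (∑<-+ a b f) ⟩
  ∑< a f + ∑[ i < b ] f (a + i) + f (a + b)     ≡⟨ +-assoc (∑< a f) _ _ ⟩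
  ∑< a f + (∑[ i < b ] f (a + i) + f (a + b))   ≡⟨ cong (∑< a f +_) (∑<-suc b (f ∘ (a +_))) ⟨
  ∑< a f + ∑[ i < suc b ] f (a + i)             ∎
  where open ≡-Reasoning

∑<-≟ : ∀ k y → ∑[ i < k ] 𝟙 (y ≟ i) ≡ 𝟙 (y <? k)
∑<-≟ k y = trans (∑-≟ _≟_ (upTo⁺ k) y) (𝟙-⇔ (mk⇔ ∈-upTo⁻ ∈-upTo⁺) (y ∈? upTo k) (y <? k))
  where open import Data.List.Membership.DecPropositional _≟_ using (_∈?_)

𝟙-interval : ∀ lo len p → 𝟙 (lo ≤? p) * 𝟙 (p <? lo + len) ≡ ∑[ i < len ] 𝟙 (p ≟ lo + i)
𝟙-interval zero     len p = begin
  𝟙 (0 ≤? p) * 𝟙 (p <? len)   ≡⟨ cong (_* 𝟙 (p <? len)) (𝟙-yes (0 ≤? p) z≤n) ⟩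
  1 * 𝟙 (p <? len)            ≡⟨ *-identityˡ _ ⟩
  𝟙 (p <? len)                ≡⟨ ∑<-≟ len p ⟨
  ∑[ i < len ] 𝟙 (p ≟ i)      ∎
  where open ≡-Reasoning
𝟙-interval (suc lo) len zero = begin
  𝟙 (suc lo ≤? 0) * 𝟙 (0 <? suc lo + len)   ≡⟨ cong (_* 𝟙 (0 <? suc lo + len)) (𝟙-no (suc lo ≤? 0) λ ()) ⟩
  0                                         ≡⟨ ∑-0 (upTo len) ⟨
  ∑[ i < len ] 0                            ≡⟨ ∑-cong (upTo len) (λ i → 𝟙-no (0 ≟ suc lo + i) λ ()) ⟨
  ∑[ i < len ] 𝟙 (0 ≟ suc lo + i)           ∎
  where open ≡-Reasoning
𝟙-interval (suc lo) len (suc p) = begin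
  𝟙 (suc lo ≤? suc p) * 𝟙 (suc p <? suc lo + len)
    ≡⟨ cong₂ _*_ (𝟙-⇔ (mk⇔ s≤s⁻¹ s≤s) (suc lo ≤? suc p) (lo ≤? p))
                 (𝟙-⇔ (mk⇔ s<s⁻¹ s<s) (suc p <? suc lo + len) (p <? lo + len)) ⟩
  𝟙 (lo ≤? p) * 𝟙 (p <? lo + len)
    ≡⟨ 𝟙-interval lo len p ⟩
  ∑[ i < len ] 𝟙 (p ≟ lo + i)
    ≡⟨ ∑-cong (upTo len) (λ i → 𝟙-⇔ (mk⇔ (cong suc) suc-injective) (p ≟ lo + i) (suc p ≟ suc lo + i)) ⟩
  ∑[ i < len ] 𝟙 (suc p ≟ suc lo + i)
    ∎
  where open ≡-Reasoning

module _ (k : ℕ) .{{_ : NonZero k}} where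

  ∑<-≟-% : ∀ x {y} → y < k → ∑[ i < k ] 𝟙 (y ≟ (x + i) % k) ≡ 1
  ∑<-≟-% zero {y} y<k = begin
    ∑[ i < k ] 𝟙 (y ≟ i % k)   ≡⟨ ∑<-cong k (λ i<k → cong (λ t → 𝟙 (y ≟ t)) (m<n⇒m%n≡m i<k)) ⟩
    ∑[ i < k ] 𝟙 (y ≟ i)       ≡⟨ ∑<-≟ k y ⟩
    𝟙 (y <? k)                 ≡⟨ 𝟙-yes (y <? k) y<k ⟩
    1                          ∎
    where open ≡-Reasoning
  ∑<-≟-% (suc x) {y} y<k = +-cancelˡ-≡ (g x) _ _ (begin
    g x + ∑[ i < k ] g (suc x + i)
      ≡⟨ cong₂ _+_ (cong g (+-identityʳ x)) (∑<-cong k (λ {i} _ → cong g (+-suc x i))) ⟨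
    g (x + 0) + ∑[ i < k ] g (x + suc i)
      ≡⟨ ∑<-sucˡ k (g ∘ (x +_)) ⟨
    ∑[ i < suc k ] g (x + i)
      ≡⟨ ∑<-suc k (g ∘ (x +_)) ⟩
    ∑[ i < k ] g (x + i) + g (x + k)
      ≡⟨ cong₂ _+_ (∑<-≟-% x y<k) (cong (λ t → 𝟙 (y ≟ t)) ([m+n]%n≡m%n x k)) ⟩
    1 + g x
      ≡⟨ +-comm 1 (g x) ⟩
    g x + 1
      ∎)
    where
    open ≡-Reasoning
    g : ℕ → ℕ
    g t = 𝟙 (y ≟ t % k)

  %-+-congʳ : ∀ {x y} c → x % k ≡ y % k → (x + c) % k ≡ (y + c) % k
  %-+-congʳ {x} {y} c eq = begin
    (x + c) % k           ≡⟨ %-distribˡ-+ x c k ⟩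
    (x % k + c % k) % k   ≡⟨ cong (λ t → (t + c % k) % k) eq ⟩
    (y % k + c % k) % k   ≡⟨ %-distribˡ-+ y c k ⟨
    (y + c) % k           ∎
    where open ≡-Reasoning

  %-+-cancelʳ : ∀ {x y} c → (x + c) % k ≡ (y + c) % k → x % k ≡ y % k
  %-+-cancelʳ {x} {y} c eq = begin
    x % k                      ≡⟨ [m+kn]%n≡m%n x c k ⟨
    (x + c * k) % k            ≡⟨ cong (_% k) (complete x) ⟨
    (x + c + c * pred k) % k   ≡⟨ %-+-congʳ (c * pred k) eq ⟩
    (y + c + c * pred k) % k   ≡⟨ cong (_% k) (complete y) ⟩
    (y + c * k) % k            ≡⟨ [m+kn]%n≡m%n y c k ⟩
    y % k                      ∎
    where
    open ≡-Reasoning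
    complete : ∀ z → z + c + c * pred k ≡ z + c * k
    complete z = trans (+-assoc z c _) (cong (z +_) (trans (sym (*-suc c (pred k))) (cong (c *_) (suc-pred k))))

  %-+-⇔ : ∀ {x y} c → y < k → (x % k ≡ y) ⇔ ((x + c) % k ≡ (y + c) % k)
  %-+-⇔ c y<k = mk⇔ (λ eq → %-+-congʳ c (trans eq (sym (m<n⇒m%n≡m y<k))))
                    (λ eq → trans (%-+-cancelʳ c eq) (m<n⇒m%n≡m y<k))

-- Counting permutations

module _ {n : ℕ} where

  ∑-allVecs-∷ : ∀ l (f : Vec (Fin n) (suc l) → ℕ) →
                ∑ (allVecs (suc l)) f ≡ ∑[ x ∈ allFin n ] ∑[ w ∈ allVecs l ] f (x ∷ w)
  ∑-allVecs-∷ l f = trans (∑-concatMap (allFin n) _ f) (∑-cong (allFin n) (λ x → ∑-map (allVecs l) (x ∷_) f))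

  ∑-allVecs-∷ʳ : ∀ l (f : Vec (Fin n) (suc l) → ℕ) →
                 ∑ (allVecs (suc l)) f ≡ ∑[ w ∈ allVecs l ] ∑[ x ∈ allFin n ] f (w ∷ʳ x)
  ∑-allVecs-∷ʳ zero    f =
    trans (∑-allVecs-∷ 0 f) (trans (∑-cong (allFin n) (λ x → +-identityʳ _)) (sym (+-identityʳ _)))
  ∑-allVecs-∷ʳ (suc l) f = begin
    ∑ (allVecs (2 + l)) f
      ≡⟨ ∑-allVecs-∷ (suc l) f ⟩
    ∑[ x ∈ allFin n ] ∑[ w ∈ allVecs (suc l) ] f (x ∷ w)
      ≡⟨ ∑-cong (allFin n) (λ x → ∑-allVecs-∷ʳ l (f ∘ (x ∷_))) ⟩
    ∑[ x ∈ allFin n ] ∑[ w ∈ allVecs l ] ∑[ y ∈ allFin n ] f (x ∷ (w ∷ʳ y))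
      ≡⟨ ∑-allVecs-∷ l (λ w → ∑[ y ∈ allFin n ] f (w ∷ʳ y)) ⟨
    ∑[ w ∈ allVecs (suc l) ] ∑[ y ∈ allFin n ] f (w ∷ʳ y)
      ∎
    where open ≡-Reasoning

  ∑-allVecs-rotate : ∀ l (f : Vec (Fin n) (suc l) → ℕ) →
                     ∑[ x ∈ allFin n ] ∑[ w ∈ allVecs l ] f (w ∷ʳ x) ≡ ∑ (allVecs (suc l)) f
  ∑-allVecs-rotate l f = trans (∑-swap (allFin n) (allVecs l) _) (sym (∑-allVecs-∷ʳ l f))

  open import Data.List.Membership.DecPropositional (Fin._≟_ {n}) using (_∈?_; _∉?_)
  open import Data.List.Relation.Unary.Unique.DecPropositional (Fin._≟_ {n}) using (unique?)
  open import Data.List.Relation.Binary.Permutation.Setoid (setoid (Fin n)) using (↭-sym)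
  open import Data.List.Relation.Binary.Permutation.Setoid.Properties (setoid (Fin n)) using (Unique-resp-↭; ∷↭∷ʳ)

  unique-∷ʳ : ∀ {xs : List (Fin n)} {x} → Unique (xs ++ [ x ]) ⇔ (Unique xs × x ∉ xs)
  unique-∷ʳ {xs} {x} = mk⇔ to from
    where
    to : Unique (xs ++ [ x ]) → Unique xs × x ∉ xs
    to u with x≢xs ∷ u′ ← Unique-resp-↭ (↭-sym (∷↭∷ʳ x xs)) u = u′ , All¬⇒¬Any x≢xs
    from : Unique xs × x ∉ xs → Unique (xs ++ [ x ])
    from (u , x∉xs) = Unique-resp-↭ (∷↭∷ʳ x xs) (¬Any⇒All¬ xs x∉xs ∷ u)

  ∑-∈-allFin : ∀ {xs} → Unique xs → ∑[ x ∈ allFin n ] 𝟙 (x ∈? xs) ≡ length xs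
  ∑-∈-allFin {xs} u = begin
    ∑[ x ∈ allFin n ] 𝟙 (x ∈? xs)
      ≡⟨ ∑-cong (allFin n) (∑-≟ Fin._≟_ u) ⟨
    ∑[ x ∈ allFin n ] ∑[ y ∈ xs ] 𝟙 (x Fin.≟ y)
      ≡⟨ ∑-swap (allFin n) xs _ ⟩
    ∑[ y ∈ xs ] ∑[ x ∈ allFin n ] 𝟙 (x Fin.≟ y)
      ≡⟨ ∑-cong xs (λ y → ∑-cong (allFin n) (λ x → 𝟙-⇔ (mk⇔ sym sym) (x Fin.≟ y) (y Fin.≟ x))) ⟩
    ∑[ y ∈ xs ] ∑[ x ∈ allFin n ] 𝟙 (y Fin.≟ x)
      ≡⟨ ∑-cong xs (∑-≟ Fin._≟_ (allFin⁺ n)) ⟩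
    ∑[ y ∈ xs ] 𝟙 (y ∈? allFin n)
      ≡⟨ ∑-cong xs (λ y → 𝟙-yes (y ∈? allFin n) (∈-allFin y)) ⟩
    ∑[ y ∈ xs ] 1
      ≡⟨ ∑-const xs 1 ⟩
    length xs * 1
      ≡⟨ *-identityʳ (length xs) ⟩
    length xs
      ∎
    where open ≡-Reasoning

  ∑-∉-allFin : ∀ {xs} → Unique xs → ∑[ x ∈ allFin n ] 𝟙 (x ∉? xs) ≡ n ∸ length xs
  ∑-∉-allFin {xs} u = begin
    #∉                 ≡⟨ m+n∸m≡n #∈ #∉ ⟨
    #∈ + #∉ ∸ #∈       ≡⟨ cong₂ _∸_ #∈+#∉≡n (∑-∈-allFin u) ⟩
    n ∸ length xs      ∎
    where
    open ≡-Reasoning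
    #∈ #∉ : ℕ
    #∈ = ∑[ x ∈ allFin n ] 𝟙 (x ∈? xs)
    #∉ = ∑[ x ∈ allFin n ] 𝟙 (x ∉? xs)
    #∈+#∉≡n : #∈ + #∉ ≡ n
    #∈+#∉≡n = begin
      #∈ + #∉                                         ≡⟨ ∑-+ (allFin n) _ _ ⟨
      ∑[ x ∈ allFin n ] (𝟙 (x ∈? xs) + 𝟙 (x ∉? xs))   ≡⟨ ∑-cong (allFin n) (λ x → 𝟙-¬ (x ∈? xs)) ⟩
      ∑[ x ∈ allFin n ] 1                             ≡⟨ ∑-const (allFin n) 1 ⟩
      length (allFin n) * 1                           ≡⟨ *-identityʳ _ ⟩
      length (allFin n)                               ≡⟨ length-tabulate id ⟩
      n                                               ∎

  𝟙-unique-∷ʳ : ∀ {l} (w : Vec (Fin n) l) x →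
                𝟙 (unique? (toList (w ∷ʳ x))) ≡ 𝟙 (unique? (toList w)) * 𝟙 (x ∉? toList w)
  𝟙-unique-∷ʳ w x = begin
    𝟙 (unique? (toList (w ∷ʳ x)))
      ≡⟨ cong (𝟙 ∘ unique?) (toList-∷ʳ x w) ⟩
    𝟙 (unique? (toList w ++ [ x ]))
      ≡⟨ 𝟙-⇔ unique-∷ʳ (unique? (toList w ++ [ x ])) (unique? (toList w) ×-dec x ∉? toList w) ⟩
    𝟙 (unique? (toList w) ×-dec x ∉? toList w)
      ≡⟨ 𝟙-× (unique? (toList w)) (x ∉? toList w) ⟩
    𝟙 (unique? (toList w)) * 𝟙 (x ∉? toList w)
      ∎
    where open ≡-Reasoning

  uniqueWords : ℕ → ℕ
  uniqueWords l = ∑[ w ∈ allVecs l ] 𝟙 (unique? (toList w))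

  uniqueWords-suc : ∀ l → uniqueWords (suc l) ≡ uniqueWords l * (n ∸ l)
  uniqueWords-suc l = begin
    uniqueWords (suc l)
      ≡⟨ ∑-allVecs-∷ʳ l _ ⟩
    ∑[ w ∈ allVecs l ] ∑[ x ∈ allFin n ] 𝟙 (unique? (toList (w ∷ʳ x)))
      ≡⟨ ∑-cong (allVecs l) (λ w → ∑-cong (allFin n) (𝟙-unique-∷ʳ w)) ⟩
    ∑[ w ∈ allVecs l ] ∑[ x ∈ allFin n ] 𝟙 (unique? (toList w)) * 𝟙 (x ∉? toList w)
      ≡⟨ ∑-cong (allVecs l) (λ w → ∑-*ˡ (allFin n) (𝟙 (unique? (toList w))) (λ x → 𝟙 (x ∉? toList w))) ⟩
    ∑[ w ∈ allVecs l ] 𝟙 (unique? (toList w)) * (∑[ x ∈ allFin n ] 𝟙 (x ∉? toList w))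
      ≡⟨ ∑-cong (allVecs l) (λ w → 𝟙-*-cong (unique? (toList w)) (λ u →
           trans (∑-∉-allFin u) (cong (n ∸_) (length-toList w)))) ⟩
    ∑[ w ∈ allVecs l ] 𝟙 (unique? (toList w)) * (n ∸ l)
      ≡⟨ ∑-*ʳ (allVecs l) _ (n ∸ l) ⟩
    uniqueWords l * (n ∸ l)
      ∎
    where open ≡-Reasoning

  uniqueWords-! : ∀ l → l ≤ n → uniqueWords l * (n ∸ l) ! ≡ n !
  uniqueWords-! zero    _   = +-identityʳ (n !)
  uniqueWords-! (suc l) l<n = begin
    uniqueWords (suc l) * (n ∸ suc l) !
      ≡⟨ cong (_* (n ∸ suc l) !) (uniqueWords-suc l) ⟩
    uniqueWords l * (n ∸ l) * (n ∸ suc l) !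
      ≡⟨ *-assoc (uniqueWords l) (n ∸ l) _ ⟩
    uniqueWords l * ((n ∸ l) * (n ∸ suc l) !)
      ≡⟨ cong (λ t → uniqueWords l * (t * (n ∸ suc l) !)) n∸l≡1+n∸[1+l] ⟩
    uniqueWords l * suc (n ∸ suc l) !
      ≡⟨ cong (λ t → uniqueWords l * t !) n∸l≡1+n∸[1+l] ⟨
    uniqueWords l * (n ∸ l) !
      ≡⟨ uniqueWords-! l (<⇒≤ l<n) ⟩
    n !
      ∎
    where
    open ≡-Reasoning
    n∸l≡1+n∸[1+l] : n ∸ l ≡ suc (n ∸ suc l)
    n∸l≡1+n∸[1+l] = +-∸-assoc 1 l<n

  ∑-isPerm : ∑[ w ∈ allVecs n ] 𝟙 (isPerm? w) ≡ n !
  ∑-isPerm = begin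
    uniqueWords n               ≡⟨ *-identityʳ _ ⟨
    uniqueWords n * 1           ≡⟨ cong (λ t → uniqueWords n * t !) (n∸n≡0 n) ⟨
    uniqueWords n * (n ∸ n) !   ≡⟨ uniqueWords-! n ≤-refl ⟩
    n !                         ∎
    where open ≡-Reasoning

-- The major index under a cyclic shift of values

<ᵇ-true : ∀ {m n} → m < n → (m <ᵇ n) ≡ true
<ᵇ-true = Equivalence.to T-≡ ∘ <⇒<ᵇ

<ᵇ-false : ∀ m n → n ≤ m → (m <ᵇ n) ≡ false
<ᵇ-false m n n≤m with m <ᵇ n | <ᵇ⇒< m n
... | false | _   = refl
... | true  | m<n = contradiction (m<n _) (≤⇒≯ n≤m)

majFrom-suc : ∀ t a xs → majFrom t (suc a) (map suc xs) ≡ majFrom t a xs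
majFrom-suc t a []       = refl
majFrom-suc t a (b ∷ xs) = cong ((if b <ᵇ a then t else 0) +_) (majFrom-suc (suc t) b xs)

module _ {N : ℕ} where

  majFrom-lower-max : ∀ t a as {b} bs → 0 < a → a < N → All (λ x → 0 < x × x < N) as → b < N →
    majFrom t a (as ++ N ∷ b ∷ bs) ≡ suc (majFrom t (suc a) (map suc as ++ 1 ∷ suc b ∷ map suc bs))
  majFrom-lower-max t a@(suc _) [] {b} bs _ a<N [] b<N rewrite <ᵇ-false N a (<⇒≤ a<N) | <ᵇ-true b<N =
    cong (λ x → suc (t + x)) (sym (majFrom-suc (2 + t) b bs))
  majFrom-lower-max t a (x ∷ as) bs 0<a a<N ((0<x , x<N) ∷ as<N) b<N =
    trans (cong ((if x <ᵇ a then t else 0) +_) (majFrom-lower-max (suc t) x as bs 0<x x<N as<N b<N)) (+-suc _ _)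

  maj-lower-max : ∀ as {b} bs → All (λ x → 0 < x × x < N) as → b < N →
    maj (as ++ N ∷ b ∷ bs) ≡ suc (maj (map suc as ++ 1 ∷ suc b ∷ map suc bs))
  maj-lower-max []       {b} bs []                    b<N rewrite <ᵇ-true b<N = cong suc (sym (majFrom-suc 2 b bs))
  maj-lower-max (a ∷ as)     bs ((0<a , a<N) ∷ as<N) b<N = majFrom-lower-max 1 a as bs 0<a a<N as<N b<N

-- Positions of letters and rotation of a word

module _ {n : ℕ} where

  posL-pos : ∀ (xs : List (Fin n)) z → 0 < posL xs z
  posL-pos []       z = s≤s z≤n
  posL-pos (x ∷ xs) z with x Fin.≟ z
  ... | yes _ = s≤s z≤n
  ... | no  _ = s≤s z≤n

  posL-≤-length : ∀ {xs : List (Fin n)} {z} → z ∈ xs → posL xs z ≤ length xs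
  posL-≤-length {x ∷ xs} {z} z∈x∷xs with x Fin.≟ z | z∈x∷xs
  ... | yes _   | _          = s≤s z≤n
  ... | no  x≢z | here z≡x   = contradiction (sym z≡x) x≢z
  ... | no  _   | there z∈xs = s≤s (posL-≤-length z∈xs)

  posL-++-∈ : ∀ {xs : List (Fin n)} ys {z} → z ∈ xs → posL (xs ++ ys) z ≡ posL xs z
  posL-++-∈ {x ∷ xs} ys {z} z∈x∷xs with x Fin.≟ z | z∈x∷xs
  ... | yes _   | _          = refl
  ... | no  x≢z | here z≡x   = contradiction (sym z≡x) x≢z
  ... | no  _   | there z∈xs = cong suc (posL-++-∈ ys z∈xs)

  posL-++-∉ : ∀ (xs : List (Fin n)) ys {z} → z ∉ xs → posL (xs ++ ys) z ≡ length xs + posL ys z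
  posL-++-∉ []       ys z∉xs = refl
  posL-++-∉ (x ∷ xs) ys {z} z∉x∷xs with x Fin.≟ z
  ... | yes x≡z = contradiction (here (sym x≡z)) z∉x∷xs
  ... | no  _   = cong suc (posL-++-∉ xs ys (z∉x∷xs ∘ there))

  posL-head : ∀ y (xs : List (Fin n)) → posL (y ∷ xs) y ≡ 1
  posL-head y xs with y Fin.≟ y
  ... | yes _   = refl
  ... | no  y≢y = contradiction refl y≢y

toList-unique⁻ : ∀ {a} {A : Set a} {l} {w : Vec A l} → Unique (toList w) → Vecᵘ.Unique w
toList-unique⁻ {w = []}    []          = []
toList-unique⁻ {w = x ∷ w} (x≢w ∷ u) = Vecᴬ.toList⁻ x≢w ∷ toList-unique⁻ u

perm-surjective : ∀ {n} {w : Word n} → IsPerm w → ∀ z → z ∈ toList w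
perm-surjective {suc m} {w} perm z with any? (z Fin.≟_) (toList w)
... | yes z∈w = z∈w
... | no  z∉w = contradiction (Fin.pigeonhole (n<1+n m) punch) no-collision
  where
  z≢wᵢ : ∀ i → z ≢ lookup w i
  z≢wᵢ i z≡wᵢ = z∉w (subst (_∈ toList w) (sym z≡wᵢ) (∈-toList⁺ (∈-lookup i w)))
  punch : Fin (suc m) → Fin m
  punch i = punchOut (z≢wᵢ i)
  no-collision : ¬ ∃₂ λ i j → i <ᶠ j × punch i ≡ punch j
  no-collision (i , j , i<j , eq) =
    Fin.<⇒≢ i<j (lookup-injective (toList-unique⁻ perm) i j (Fin.punchOut-injective (z≢wᵢ i) (z≢wᵢ j) eq))

posMax-range : ∀ {m} {w : Word (suc m)} → IsPerm w → 0 < posMax w × posMax w ≤ suc m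
posMax-range {m} {w} perm = posL-pos (toList w) (fromℕ m) , (begin
  posMax w            ≤⟨ posL-≤-length (perm-surjective perm (fromℕ m)) ⟩
  length (toList w)   ≡⟨ length-toList w ⟩
  suc m               ∎)
  where open ≤-Reasoning

allFin-∷ʳ : ∀ m → ∃ λ xs → allFin (suc m) ≡ xs ++ [ fromℕ m ]
allFin-∷ʳ zero    = [] , refl
allFin-∷ʳ (suc m) with xs , eq ← allFin-∷ʳ m = zero ∷ map suc xs , cong (zero ∷_) (begin
  tabulate suc                      ≡⟨ map-tabulate id suc ⟨
  map suc (allFin (suc m))          ≡⟨ cong (map suc) eq ⟩
  map suc (xs ++ [ fromℕ m ])       ≡⟨ map-++ suc xs _ ⟩
  map suc xs ++ [ fromℕ (suc m) ]   ∎)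
  where open ≡-Reasoning

module _ {m : ℕ} where

  open import Data.List.Relation.Binary.Permutation.Setoid (setoid (Fin (suc m))) using (↭-sym)
  open import Data.List.Relation.Binary.Permutation.Setoid.Properties (setoid (Fin (suc m)))
    using (Unique-resp-↭; ↭-shift; ∷↭∷ʳ)

  allFin-split : ∀ (y : Fin (suc m)) → y ≢ fromℕ m →
    ∃₂ λ pre z → ∃ λ post → allFin (suc m) ≡ pre ++ y ∷ z ∷ post × All (y ≢_) (pre ++ z ∷ post)
  allFin-split y y≢max with ∈-∃++ (∈-allFin y)
  ... | pre , [] , eq with xs , eq′ ← allFin-∷ʳ m =
    contradiction (sym (∷ʳ-injectiveʳ xs pre (trans (sym eq′) eq))) y≢max
  ... | pre , z ∷ post , eq
    with y≢others ∷ _ ← Unique-resp-↭ (↭-shift pre (z ∷ post)) (subst Unique eq (allFin⁺ (suc m))) =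
    pre , z , post , eq , y≢others

  module Rotation (v : Vec (Fin (suc m)) m) (y : Fin (suc m)) where

    isPerm-rotate : IsPerm (y ∷ v) ⇔ IsPerm (v ∷ʳ y)
    isPerm-rotate = mk⇔
      (λ perm → subst Unique (sym (toList-∷ʳ y v)) (Unique-resp-↭ (∷↭∷ʳ y (toList v)) perm))
      (λ perm → Unique-resp-↭ (↭-sym (∷↭∷ʳ y (toList v))) (subst Unique (toList-∷ʳ y v) perm))

    invAt-rotate-last : invAt (y ∷ v) y ≡ 1
    invAt-rotate-last = posL-head y (toList v)

    posMax-rotate-max : y ≡ fromℕ m → posMax (y ∷ v) ≡ 1
    posMax-rotate-max y≡max = trans (cong (invAt (y ∷ v)) (sym y≡max)) invAt-rotate-last

    module _ (perm : IsPerm (v ∷ʳ y)) where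

      private
        xs : List (Fin (suc m))
        xs = toList v

        y∉xs : y ∉ xs
        y∉xs = proj₂ (Equivalence.to unique-∷ʳ (subst Unique (toList-∷ʳ y v) perm))

        ∈xs : ∀ {z} → y ≢ z → z ∈ xs
        ∈xs {z} y≢z with ∈-++⁻ xs (subst (z ∈_) (toList-∷ʳ y v) (perm-surjective perm z))
        ... | inj₁ z∈xs        = z∈xs
        ... | inj₂ (here z≡y) = contradiction (sym z≡y) y≢z

        invAt-other : ∀ {z} → y ≢ z → invAt (v ∷ʳ y) z ≡ posL xs z
        invAt-other {z} y≢z = trans (cong (λ l → posL l z) (toList-∷ʳ y v)) (posL-++-∈ [ y ] (∈xs y≢z))

      invAt-last : invAt (v ∷ʳ y) y ≡ suc m
      invAt-last = begin
        posL (toList (v ∷ʳ y)) y   ≡⟨ cong (λ l → posL l y) (toList-∷ʳ y v) ⟩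
        posL (xs ++ [ y ]) y       ≡⟨ posL-++-∉ xs [ y ] y∉xs ⟩
        length xs + posL [ y ] y   ≡⟨ cong₂ _+_ (length-toList v) (posL-head y []) ⟩
        m + 1                      ≡⟨ +-comm m 1 ⟩
        suc m                      ∎
        where open ≡-Reasoning

      posMax-max : y ≡ fromℕ m → posMax (v ∷ʳ y) ≡ suc m
      posMax-max y≡max = trans (cong (invAt (v ∷ʳ y)) (sym y≡max)) invAt-last

      invAt-other-range : ∀ {z} → y ≢ z → 0 < invAt (v ∷ʳ y) z × invAt (v ∷ʳ y) z < suc m
      invAt-other-range {z} y≢z = posL-pos (toList (v ∷ʳ y)) z , s≤s (begin
        invAt (v ∷ʳ y) z   ≡⟨ invAt-other y≢z ⟩
        posL xs z          ≤⟨ posL-≤-length (∈xs y≢z) ⟩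
        length xs          ≡⟨ length-toList v ⟩
        m                  ∎)
        where open ≤-Reasoning

      invAt-rotate-other : ∀ {z} → y ≢ z → invAt (y ∷ v) z ≡ suc (invAt (v ∷ʳ y) z)
      invAt-rotate-other {z} y≢z =
        trans (posL-++-∉ [ y ] xs λ { (here z≡y) → y≢z (sym z≡y) }) (cong suc (sym (invAt-other y≢z)))

      posMax-rotate : y ≢ fromℕ m → posMax (y ∷ v) ≡ suc (posMax (v ∷ʳ y))
      posMax-rotate = invAt-rotate-other

      majInv-rotate : y ≢ fromℕ m → majInv (v ∷ʳ y) ≡ suc (majInv (y ∷ v))
      majInv-rotate y≢max
        with pre , z , post , eq , y≢others ← allFin-split y y≢max
        with y≢pre , y≢z ∷ y≢post ← All.++⁻ pre y≢others = begin
        maj (map f (allFin (suc m)))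
          ≡⟨ cong (maj ∘ map f) eq ⟩
        maj (map f (pre ++ y ∷ z ∷ post))
          ≡⟨ cong maj (map-++ f pre _) ⟩
        maj (map f pre ++ f y ∷ f z ∷ map f post)
          ≡⟨ cong (λ t → maj (map f pre ++ t ∷ f z ∷ map f post)) invAt-last ⟩
        maj (map f pre ++ suc m ∷ f z ∷ map f post)
          ≡⟨ maj-lower-max (map f pre) (map f post)
                           (All.map⁺ (All.map invAt-other-range y≢pre)) (proj₂ (invAt-other-range y≢z)) ⟩
        suc (maj (map suc (map f pre) ++ 1 ∷ suc (f z) ∷ map suc (map f post)))
          ≡⟨ cong (suc ∘ maj) rotated ⟨
        suc (maj (map g (allFin (suc m))))
          ∎
        where
        open ≡-Reasoning
        f g : Fin (suc m) → ℕ
        f = invAt (v ∷ʳ y)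
        g = invAt (y ∷ v)
        g≡suc∘f : ∀ {zs} → All (y ≢_) zs → map g zs ≡ map suc (map f zs)
        g≡suc∘f {zs} y≢zs = trans (map-cong-local (All.map invAt-rotate-other y≢zs)) (map-∘ zs)
        rotated : map g (allFin (suc m)) ≡ map suc (map f pre) ++ 1 ∷ suc (f z) ∷ map suc (map f post)
        rotated = begin
          map g (allFin (suc m))                ≡⟨ cong (map g) eq ⟩
          map g (pre ++ y ∷ z ∷ post)           ≡⟨ map-++ g pre _ ⟩
          map g pre ++ g y ∷ g z ∷ map g post   ≡⟨ cong₂ _++_ (g≡suc∘f y≢pre)
                                                         (cong₂ _∷_ invAt-rotate-last (g≡suc∘f (y≢z ∷ y≢post))) ⟩
          map suc (map f pre) ++ 1 ∷ suc (f z) ∷ map suc (map f post) ∎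

-- The rotation invariant maj(σ⁻¹) + σ⁻¹(n)

module MaxAt (m : ℕ) where

  weight : ℕ → (ℕ → ℕ) → Word (suc m) → ℕ
  weight p g w = 𝟙 (isPerm? w) * (𝟙 (posMax w ≟ p) * g (majInv w + posMax w))

  ∑maxAt : ℕ → (ℕ → ℕ) → ℕ
  ∑maxAt p g = ∑[ w ∈ allVecs (suc m) ] weight p g w

  weight-rotate : ∀ {p} g → 0 < p → p < suc m → ∀ v y → weight (suc p) g (y ∷ v) ≡ weight p g (v ∷ʳ y)
  weight-rotate {p} g 0<p p<n v y = begin
    𝟙 (isPerm? (y ∷ v)) * atMax (suc p) (y ∷ v)
      ≡⟨ cong (_* atMax (suc p) (y ∷ v)) (𝟙-⇔ isPerm-rotate (isPerm? (y ∷ v)) (isPerm? (v ∷ʳ y))) ⟩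
    𝟙 (isPerm? (v ∷ʳ y)) * atMax (suc p) (y ∷ v)
      ≡⟨ 𝟙-*-cong (isPerm? (v ∷ʳ y)) (λ perm → rotated perm (y Fin.≟ fromℕ m)) ⟩
    𝟙 (isPerm? (v ∷ʳ y)) * atMax p (v ∷ʳ y)
      ∎
    where
    open ≡-Reasoning
    open Rotation v y
    atMax : ℕ → Word (suc m) → ℕ
    atMax q w = 𝟙 (posMax w ≟ q) * g (majInv w + posMax w)
    rotated : IsPerm (v ∷ʳ y) → Dec (y ≡ fromℕ m) → atMax (suc p) (y ∷ v) ≡ atMax p (v ∷ʳ y)
    rotated perm (yes y≡max) = trans (cong (_* _) (𝟙-no (posMax (y ∷ v) ≟ suc p) posMax≢1+p))
                                     (cong (_* _) (sym (𝟙-no (posMax (v ∷ʳ y) ≟ p) posMax≢p)))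
      where
      posMax≢1+p : posMax (y ∷ v) ≢ suc p
      posMax≢1+p eq = <⇒≢ 0<p (suc-injective (trans (sym (posMax-rotate-max y≡max)) eq))
      posMax≢p : posMax (v ∷ʳ y) ≢ p
      posMax≢p eq = <⇒≢ p<n (trans (sym eq) (posMax-max perm y≡max))
    rotated perm (no y≢max) rewrite posMax-rotate perm y≢max | majInv-rotate perm y≢max =
      cong₂ _*_ (𝟙-⇔ (mk⇔ suc-injective (cong suc)) (suc P ≟ suc p) (P ≟ p))
                (cong g (+-suc (majInv (y ∷ v)) P))
      where P = posMax (v ∷ʳ y)

  ∑maxAt-suc : ∀ {p} g → 0 < p → p < suc m → ∑maxAt (suc p) g ≡ ∑maxAt p g
  ∑maxAt-suc {p} g 0<p p<n = begin
    ∑maxAt (suc p) g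
      ≡⟨ ∑-allVecs-∷ m (weight (suc p) g) ⟩
    ∑[ y ∈ allFin (suc m) ] ∑[ v ∈ allVecs m ] weight (suc p) g (y ∷ v)
      ≡⟨ ∑-cong (allFin (suc m)) (λ y → ∑-cong (allVecs m) (λ v → weight-rotate g 0<p p<n v y)) ⟩
    ∑[ y ∈ allFin (suc m) ] ∑[ v ∈ allVecs m ] weight p g (v ∷ʳ y)
      ≡⟨ ∑-allVecs-rotate m (weight p g) ⟩
    ∑maxAt p g
      ∎
    where open ≡-Reasoning

  ∑maxAt-constant : ∀ {p} g → 0 < p → p ≤ suc m → ∑maxAt p g ≡ ∑maxAt 1 g
  ∑maxAt-constant {suc zero}    g _ _   = refl
  ∑maxAt-constant {suc (suc p)} g _ p<n = trans (∑maxAt-suc g z<s p<n) (∑maxAt-constant g z<s (<⇒≤ p<n))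

  ∑maxAt-cong : ∀ p {g h} → (∀ φ → g φ ≡ h φ) → ∑maxAt p g ≡ ∑maxAt p h
  ∑maxAt-cong p g≗h =
    ∑-cong (allVecs (suc m)) λ w → cong (λ t → 𝟙 (isPerm? w) * (𝟙 (posMax w ≟ p) * t)) (g≗h _)

  ∑-∑maxAt : ∀ {a} {A : Set a} (xs : List A) p (g : A → ℕ → ℕ) →
             ∑[ x ∈ xs ] ∑maxAt p (g x) ≡ ∑maxAt p (λ φ → ∑[ x ∈ xs ] g x φ)
  ∑-∑maxAt xs p g = trans (∑-swap xs (allVecs (suc m)) (λ x → weight p (g x)))
    (∑-cong (allVecs (suc m)) λ w →
      trans (∑-*ˡ xs (𝟙 (isPerm? w)) _) (cong (𝟙 (isPerm? w) *_) (∑-*ˡ xs (𝟙 (posMax w ≟ p)) _)))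

  ∑maxAt-one : ∀ {p} → 0 < p → p ≤ suc m → ∑maxAt p (λ _ → 1) ≡ m !
  ∑maxAt-one 0<p p≤n = trans (∑maxAt-constant one 0<p p≤n) (*-cancelˡ-≡ _ _ (suc m) (begin
    suc m * ∑maxAt 1 one
      ≡⟨ cong (_* ∑maxAt 1 one) (length-upTo (suc m)) ⟨
    length (upTo (suc m)) * ∑maxAt 1 one
      ≡⟨ ∑-const (upTo (suc m)) _ ⟨
    ∑[ i < suc m ] ∑maxAt 1 one
      ≡⟨ ∑<-cong (suc m) (λ i<n → sym (∑maxAt-constant one z<s i<n)) ⟩
    ∑[ i < suc m ] ∑maxAt (suc i) one
      ≡⟨ ∑-swap (upTo (suc m)) (allVecs (suc m)) (λ i → weight (suc i) one) ⟩
    ∑[ w ∈ allVecs (suc m) ] ∑[ i < suc m ] weight (suc i) one w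
      ≡⟨ ∑-cong (allVecs (suc m)) max-somewhere ⟩
    ∑[ w ∈ allVecs (suc m) ] 𝟙 (isPerm? w)
      ≡⟨ ∑-isPerm {suc m} ⟩
    suc m * m !
      ∎))
    where
    open ≡-Reasoning
    one : ℕ → ℕ
    one _ = 1
    max-somewhere : ∀ w → ∑[ i < suc m ] weight (suc i) one w ≡ 𝟙 (isPerm? w)
    max-somewhere w = begin
      ∑[ i < suc m ] weight (suc i) one w                         ≡⟨ ∑-*ˡ (upTo (suc m)) (𝟙 (isPerm? w)) _ ⟩
      𝟙 (isPerm? w) * (∑[ i < suc m ] 𝟙 (posMax w ≟ suc i) * 1)   ≡⟨ 𝟙-*-cong (isPerm? w) once ⟩
      𝟙 (isPerm? w) * 1                                           ≡⟨ *-identityʳ _ ⟩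
      𝟙 (isPerm? w)                                               ∎
      where
      once : IsPerm w → ∑[ i < suc m ] (𝟙 (posMax w ≟ suc i) * 1) ≡ 1
      once perm with 0<P , P≤n ← posMax-range perm = begin
        ∑[ i < suc m ] (𝟙 (posMax w ≟ suc i) * 1)
          ≡⟨ ∑-cong (upTo (suc m)) (λ i → *-identityʳ _) ⟩
        ∑[ i < suc m ] 𝟙 (posMax w ≟ suc i)
          ≡⟨ 𝟙-interval 1 (suc m) (posMax w) ⟨
        𝟙 (1 ≤? posMax w) * 𝟙 (posMax w <? suc (suc m))
          ≡⟨ cong₂ _*_ (𝟙-yes (1 ≤? posMax w) 0<P) (𝟙-yes (posMax w <? suc (suc m)) (s≤s P≤n)) ⟩
        1
          ∎

-- Residues of maj(σ⁻¹) on windows of positions of n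

module ResidueCount (m k j : ℕ) .{{_ : NonZero k}} (j<k : j < k) where

  open MaxAt m

  indicatorAt : ℕ → Word (suc m) → ℕ
  indicatorAt q w = 𝟙 (isPerm? w) * (𝟙 (posMax w ≟ q) * 𝟙 (majInv w % k ≟ j))

  countAt : ℕ → ℕ
  countAt q = ∑[ w ∈ allVecs (suc m) ] indicatorAt q w

  countAt-∑maxAt : ∀ q → countAt q ≡ ∑maxAt q (λ φ → 𝟙 (φ % k ≟ (j + q) % k))
  countAt-∑maxAt q = ∑-cong (allVecs (suc m)) λ w → cong (𝟙 (isPerm? w) *_) (𝟙-*-cong (posMax w ≟ q) λ P≡q →
    let φ = majInv w + posMax w in
    trans (𝟙-⇔ (%-+-⇔ k (posMax w) j<k) (majInv w % k ≟ j) (φ % k ≟ (j + posMax w) % k))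
          (cong (λ t → 𝟙 (φ % k ≟ (j + t) % k)) P≡q))

  ∑-countAt-window : ∀ {lo} → 0 < lo → lo + k ≤ suc (suc m) → ∑[ i < k ] countAt (lo + i) ≡ m !
  ∑-countAt-window {lo} 0<lo lo+k≤2+m = begin
    ∑[ i < k ] countAt (lo + i)                      ≡⟨ ∑<-cong k in-range ⟩
    ∑[ i < k ] ∑maxAt 1 (residue (lo + i))           ≡⟨ ∑-∑maxAt (upTo k) 1 (residue ∘ (lo +_)) ⟩
    ∑maxAt 1 (λ φ → ∑[ i < k ] residue (lo + i) φ)   ≡⟨ ∑maxAt-cong 1 exactly-one ⟩
    ∑maxAt 1 (λ _ → 1)                               ≡⟨ ∑maxAt-one z<s (s≤s z≤n) ⟩
    m !                                              ∎
    where
    open ≡-Reasoning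
    residue : ℕ → ℕ → ℕ
    residue q φ = 𝟙 (φ % k ≟ (j + q) % k)
    in-range : ∀ {i} → i < k → countAt (lo + i) ≡ ∑maxAt 1 (residue (lo + i))
    in-range {i} i<k = trans (countAt-∑maxAt (lo + i)) (∑maxAt-constant (residue (lo + i))
      (≤-trans 0<lo (m≤m+n lo i)) (s≤s⁻¹ (<-≤-trans (+-monoʳ-< lo i<k) lo+k≤2+m)))
    exactly-one : ∀ φ → ∑[ i < k ] residue (lo + i) φ ≡ 1
    exactly-one φ = trans (∑<-cong k (λ {i} _ → cong (λ t → 𝟙 (φ % k ≟ t % k)) (sym (+-assoc j lo i))))
                          (∑<-≟-% k (j + lo) (m%n<n φ k))

  ∑-countAt-windows : ∀ s {lo} → 0 < lo → lo + s * k ≤ suc (suc m) → ∑[ i < s * k ] countAt (lo + i) ≡ s * m !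
  ∑-countAt-windows zero    _    _  = refl
  ∑-countAt-windows (suc s) {lo} 0<lo le = begin
    ∑[ i < k + s * k ] countAt (lo + i)                                   ≡⟨ ∑<-+ k (s * k) (countAt ∘ (lo +_)) ⟩
    ∑[ i < k ] countAt (lo + i) + ∑[ i < s * k ] countAt (lo + (k + i))   ≡⟨ cong₂ _+_ first rest ⟩
    m ! + s * m !                                                         ∎
    where
    open ≡-Reasoning
    first : ∑[ i < k ] countAt (lo + i) ≡ m !
    first = ∑-countAt-window 0<lo (≤-trans (+-monoʳ-≤ lo (m≤m+n k (s * k))) le)
    rest : ∑[ i < s * k ] countAt (lo + (k + i)) ≡ s * m !
    rest = trans (∑-cong (upTo (s * k)) (λ i → cong countAt (sym (+-assoc lo k i))))
                 (∑-countAt-windows s (≤-trans 0<lo (m≤m+n lo k)) (≤-trans (≤-reflexive (+-assoc lo k (s * k))) le))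

  countPerms-interval : ∀ lo hi len → lo + len ≡ suc hi →
                        countPerms (suc m) (cond? {m} k j lo hi) ≡ ∑[ i < len ] countAt (lo + i)
  countPerms-interval lo hi len lo+len≡1+hi = begin
    countPerms (suc m) (cond? k j lo hi)
      ≡⟨ length-filter-∑ (λ w → isPerm? w ×-dec cond? k j lo hi w) (allVecs (suc m)) ⟩
    ∑[ w ∈ allVecs (suc m) ] 𝟙 (isPerm? w ×-dec cond? k j lo hi w)
      ≡⟨ ∑-cong (allVecs (suc m)) split ⟩
    ∑[ w ∈ allVecs (suc m) ] ∑[ i < len ] indicatorAt (lo + i) w
      ≡⟨ ∑-swap (allVecs (suc m)) (upTo len) (λ w i → indicatorAt (lo + i) w) ⟩
    ∑[ i < len ] countAt (lo + i)
      ∎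
    where
    open ≡-Reasoning
    split : ∀ w → 𝟙 (isPerm? w ×-dec cond? k j lo hi w) ≡ ∑[ i < len ] indicatorAt (lo + i) w
    split w = begin
      𝟙 (isPerm? w ×-dec cond? k j lo hi w)
        ≡⟨ trans (𝟙-× (isPerm? w) (cond? k j lo hi w)) (cong (𝟙 (isPerm? w) *_)
                 (trans (𝟙-× (majInv w % k ≟ j) ((lo ≤? P) ×-dec (P ≤? hi)))
                        (cong (𝟙 (majInv w % k ≟ j) *_) (𝟙-× (lo ≤? P) (P ≤? hi))))) ⟩
      𝟙 (isPerm? w) * (𝟙 (majInv w % k ≟ j) * (𝟙 (lo ≤? P) * 𝟙 (P ≤? hi)))
        ≡⟨ cong (λ t → 𝟙 (isPerm? w) * (𝟙 (majInv w % k ≟ j) * (𝟙 (lo ≤? P) * t)))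
                (𝟙-⇔ ≤hi⇔<lo+len (P ≤? hi) (P <? lo + len)) ⟩
      𝟙 (isPerm? w) * (𝟙 (majInv w % k ≟ j) * (𝟙 (lo ≤? P) * 𝟙 (P <? lo + len)))
        ≡⟨ cong (λ t → 𝟙 (isPerm? w) * (𝟙 (majInv w % k ≟ j) * t)) (𝟙-interval lo len P) ⟩
      𝟙 (isPerm? w) * (𝟙 (majInv w % k ≟ j) * (∑[ i < len ] 𝟙 (P ≟ lo + i)))
        ≡⟨ cong (𝟙 (isPerm? w) *_) (∑-*ˡ (upTo len) (𝟙 (majInv w % k ≟ j)) _) ⟨
      𝟙 (isPerm? w) * (∑[ i < len ] 𝟙 (majInv w % k ≟ j) * 𝟙 (P ≟ lo + i))
        ≡⟨ ∑-*ˡ (upTo len) (𝟙 (isPerm? w)) _ ⟨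
      ∑[ i < len ] 𝟙 (isPerm? w) * (𝟙 (majInv w % k ≟ j) * 𝟙 (P ≟ lo + i))
        ≡⟨ ∑-cong (upTo len) (λ i → cong (𝟙 (isPerm? w) *_) (*-comm (𝟙 (majInv w % k ≟ j)) _)) ⟩
      ∑[ i < len ] indicatorAt (lo + i) w
        ∎
      where
      P = posMax w
      ≤hi⇔<lo+len : (P ≤ hi) ⇔ (P < lo + len)
      ≤hi⇔<lo+len = mk⇔ (λ P≤hi → subst (P <_) (sym lo+len≡1+hi) (s≤s P≤hi))
                         (λ P<lo+len → s≤s⁻¹ (subst (P <_) lo+len≡1+hi P<lo+len))

window-bounds : ∀ {n k a} → 0 < k → k ≤ n → 0 < a → a ≤ n ∸ k + 1 →
                0 < n + 2 ∸ (a + k) × n + 2 ∸ (a + k) + k ≡ suc (n ∸ a + 1) × n + 2 ∸ (a + k) + k ≤ suc n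
window-bounds {n} {k} {a} 0<k k≤n 0<a a≤n∸k+1 = 0<lo , lo+k≡1+hi , ≤-trans (≤-reflexive lo+k≡1+hi) (s≤s hi≤n)
  where
  open ≤-Reasoning
  a+k≤1+n : a + k ≤ suc n
  a+k≤1+n = begin
    a + k             ≤⟨ +-monoˡ-≤ k a≤n∸k+1 ⟩
    n ∸ k + 1 + k     ≡⟨ +-assoc (n ∸ k) 1 k ⟩
    n ∸ k + suc k     ≡⟨ +-suc (n ∸ k) k ⟩
    suc (n ∸ k + k)   ≡⟨ cong suc (m∸n+n≡m k≤n) ⟩
    suc n             ∎
  a≤n : a ≤ n
  a≤n = s≤s⁻¹ (<-≤-trans (m<m+n a 0<k) a+k≤1+n)
  a+k≤n+2 : a + k ≤ n + 2
  a+k≤n+2 = subst (a + k ≤_) (+-comm 2 n) (m≤n⇒m≤1+n a+k≤1+n)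
  0<lo : 0 < n + 2 ∸ (a + k)
  0<lo = m<n⇒0<n∸m (subst (a + k <_) (+-comm 2 n) (s≤s a+k≤1+n))
  lo+k≡1+hi : n + 2 ∸ (a + k) + k ≡ suc (n ∸ a + 1)
  lo+k≡1+hi = begin-equality
    n + 2 ∸ (a + k) + k   ≡⟨ cong (_+ k) (∸-+-assoc (n + 2) a k) ⟨
    n + 2 ∸ a ∸ k + k     ≡⟨ m∸n+n≡m (m+n≤o⇒m≤o∸n k (subst (_≤ n + 2) (+-comm a k) a+k≤n+2)) ⟩
    n + 2 ∸ a             ≡⟨ +-∸-comm 2 a≤n ⟩
    n ∸ a + 2             ≡⟨ +-suc (n ∸ a) 1 ⟩
    suc (n ∸ a + 1)       ∎
  hi≤n : n ∸ a + 1 ≤ n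
  hi≤n = begin
    n ∸ a + 1   ≤⟨ +-monoʳ-≤ (n ∸ a) 0<a ⟩
    n ∸ a + a   ≡⟨ m∸n+n≡m a≤n ⟩
    n           ∎

m∸n+1+n≡1+m : ∀ {m n} → n ≤ m → m ∸ n + 1 + n ≡ suc m
m∸n+1+n≡1+m {m} {n} n≤m = trans (+-assoc (m ∸ n) 1 n) (trans (+-suc (m ∸ n) n) (cong suc (m∸n+n≡m n≤m)))

lemma4p3 : (m k j : ℕ) .{{_ : NonZero k}} → k ≤ suc m → j < k →
    ((a : ℕ) → 1 ≤ a → a ≤ suc m ∸ k + 1 →
      countPerms (suc m) (cond? {m} k j (suc m + 2 ∸ (a + k)) (suc m ∸ a + 1)) ≡ m !)
    ×
    ((s : ℕ) → 1 ≤ s → s ≤ suc m / k →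
      countPerms (suc m) (cond? {m} k j (suc m ∸ s * k + 1) (suc m)) ≡ s * m !)
lemma4p3 m k j k≤n j<k =
  (λ a 0<a a≤n∸k+1 →
    let 0<lo , lo+k≡1+hi , lo+k≤1+n = window-bounds (>-nonZero⁻¹ k) k≤n 0<a a≤n∸k+1 in
    trans (countPerms-interval _ _ k lo+k≡1+hi) (∑-countAt-window 0<lo lo+k≤1+n)) ,
  (λ s _ s≤n/k →
    let lo+sk≡1+n = m∸n+1+n≡1+m (≤-trans (*-monoˡ-≤ k s≤n/k) (m/n*n≤m (suc m) k)) in
    trans (countPerms-interval _ _ (s * k) lo+sk≡1+n) (∑-countAt-windows s (m≤n+m 1 _) (≤-reflexive lo+sk≡1+n)))
  where open ResidueCount m k j j<k
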